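{- If $\mathscr{C}$ is a lattice closed under inverse length increasing morphisms, then its block abstraction $[\mathscr{C}]$ is a lattice.
   Context: A class $\mathscr{C}$ assigns to each alphabet $A$ a set $\mathscr{C}(A)$ of regular languages over $A$; it is a lattice if each $\mathscr{C}(A)$ contains $\emptyset$ and $A^*$ and is closed under finite unions and intersections; it is closed under inverse length increasing morphisms if $\alpha^{ -1}(L)\in\mathscr{C}(A)$ whenever $L\in\mathscr{C}(B)$ and $\alpha:A^*\to B^*$ is a monoid morphism with $\alpha(a)\neq\varepsilon$ for all $a\in A$. For $d\ge1$, $A_d$ is the alphabet whose letters are the nonempty words over $A$ of length at most $d$; $\mu_d:A^*\to A_d^*$ cuts $w$ into consecutive factors of length $d$ from the left, the last factor being of length $<d$ and omitted if empty, and returns the sequence of factors as letters. The block abstraction is $[\mathscr{C}](A)=\bigcup_{d\ge1}\{\mu_d^{ -1}(K)\mid K\in\mathscr{C}(A_d)\}$. -}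

module Defs where

open import Data.Nat using (ℕ; zero; suc; _≤_; _⊓_)
open import Data.Nat.Properties using (m⊓n≤m)
open import Data.Bool using (Bool; true; false; _∨_; _∧_)
open import Data.List using (List; []; _∷_; length; take; drop; concatMap)
open import Data.List.Properties using (length-take)
open import Data.Fin using (Fin)
open import Data.Product using (Σ; ∃; _×_; _,_)
open import Function.Bundles using (_↔_)
open import Relation.Binary.PropositionalEquality using (_≡_; _≢_; subst; sym)

IsFinite : Set → Set
IsFinite A = Σ ℕ λ n → A ↔ Fin n

Lang : Set → Set
Lang A = List A → Bool

∅ₗ : {A : Set} → Lang A
∅ₗ _ = false

Fullₗ : {A : Set} → Lang A
Fullₗ _ = true

_∪ₗ_ : {A : Set} → Lang A → Lang A → Lang A
(L ∪ₗ K) w = L w ∨ K w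

_∩ₗ_ : {A : Set} → Lang A → Lang A → Lang A
(L ∩ₗ K) w = L w ∧ K w

_≈ₗ_ : {A : Set} → Lang A → Lang A → Set
L ≈ₗ K = ∀ w → L w ≡ K w

runDFA : {A : Set} {n : ℕ} → (Fin n → A → Fin n) → Fin n → List A → Fin n
runDFA δ q [] = q
runDFA δ q (a ∷ w) = runDFA δ (δ q a) w

Regular : {A : Set} → Lang A → Set
Regular {A} L = Σ ℕ λ n → Σ (Fin n) λ q₀ → Σ (Fin n → A → Fin n) λ δ →
  Σ (Fin n → Bool) λ F → ∀ w → L w ≡ F (runDFA δ q₀ w)

-- A class of languages: to each alphabet A a set C A of regular languages
-- over A (a set of languages, hence closed under language equality).
ClassOfLangs : Set₁
ClassOfLangs = (A : Set) → Lang A → Set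

IsClass : ClassOfLangs → Set₁
IsClass C = (A : Set) → IsFinite A →
  (∀ L → C A L → Regular L) × (∀ L K → L ≈ₗ K → C A L → C A K)

IsLattice : ClassOfLangs → Set₁
IsLattice C = (A : Set) → IsFinite A →
  C A ∅ₗ × C A Fullₗ ×
  (∀ L K → C A L → C A K → C A (L ∪ₗ K)) ×
  (∀ L K → C A L → C A K → C A (L ∩ₗ K))

morph : {A B : Set} → (A → List B) → List A → List B
morph α w = concatMap α w

ClosedInvLenIncr : ClassOfLangs → Set₁
ClosedInvLenIncr C = (A B : Set) → IsFinite A → IsFinite B →
  (α : A → List B) → (∀ a → α a ≢ []) →
  ∀ L → C B L → C A (λ w → L (morph α w))

-- The alphabet A_d for d = suc e: nonempty words of length ≤ d over A,
-- represented as first letter + remaining word of length ≤ e.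
record Block (A : Set) (e : ℕ) : Set where
  constructor block
  field
    hd : A
    tl : List A
    tl≤ : length tl ≤ e

-- μ_d (d = suc e), using fuel (the length of the word suffices).
blocksF : {A : Set} (e : ℕ) → ℕ → List A → List (Block A e)
blocksF e zero w = []
blocksF e (suc k) [] = []
blocksF e (suc k) (a ∷ w) =
  block a (take e w) (subst (_≤ e) (sym (length-take e w)) (m⊓n≤m e (length w)))
  ∷ blocksF e k (drop e w)

μ : {A : Set} (e : ℕ) → List A → List (Block A e)
μ e w = blocksF e (length w) w

BlockAbs : ClassOfLangs → ClassOfLangs
BlockAbs C A L = Σ ℕ λ e → Σ (Lang (Block A e)) λ K →
  C (Block A e) K × (∀ w → L w ≡ K (μ e w))

-- Cutting a word into blocks of length d commutes with concatenation as long
-- as the first factor has length divisible by d. Hence if d ∣ d', the blocks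
-- of length d are obtained from those of length d' by the length increasing
-- morphism cutting each d'-block into d-blocks, so a language in [C] given at
-- block size d is also given at every multiple of d. Two languages in [C]
-- thus live at the common block size d₁d₂, where C is a lattice.

module Submission where

open import Defs
open import Data.Bool using (Bool; _∨_; _∧_)
open import Data.Fin.Properties using (+↔⊎; *↔×; 1↔⊤)
open import Data.List using (List; []; _∷_; _++_; length; take; drop)
open import Data.List.Properties using (length-take; length-drop; take-all; drop-all; take++drop≡id; ++-identityʳ)
open import Data.Nat using (ℕ; zero; suc; _+_; _*_; _∸_; _≤_; z≤n; s≤s; _≤?_)
open import Data.Nat.Divisibility using (_∣_; divides; m∣m*n; n∣m*n)
open import Data.Nat.Properties
  using (≤-irrelevant; ≤-refl; ≤-trans; ≤-reflexive; m⊓n≤m; m∸n≤m; m+n∸m≡n; m≤m+n; m≤n⇒m⊓n≡m; suc-injective; ≰⇒>; <⇒≤)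
open import Data.Product using (Σ; _×_; _,_; proj₁; proj₂)
open import Data.Product.Function.NonDependent.Propositional using (_×-↔_)
open import Data.Sum using (_⊎_; inj₁; inj₂)
open import Data.Sum.Function.Propositional using (_⊎-↔_)
open import Data.Unit using (⊤; tt)
open import Function.Bundles using (_↔_; mk↔ₛ′)
open import Function.Properties.Inverse using (↔-trans; ↔-sym)
open import Relation.Binary.PropositionalEquality using (_≡_; _≢_; refl; sym; trans; cong; cong₂; module ≡-Reasoning)
open import Relation.Nullary using (yes; no)

IsFinite-↔ : {A B : Set} → A ↔ B → IsFinite B → IsFinite A
IsFinite-↔ A↔B (n , B↔Fin) = n , ↔-trans A↔B B↔Fin

IsFinite-× : {A B : Set} → IsFinite A → IsFinite B → IsFinite (A × B)
IsFinite-× (m , f) (n , g) = m * n , ↔-trans (f ×-↔ g) (↔-sym *↔×)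

IsFinite-⊤⊎ : {B : Set} → IsFinite B → IsFinite (⊤ ⊎ B)
IsFinite-⊤⊎ (n , g) = 1 + n , ↔-trans (↔-sym 1↔⊤ ⊎-↔ g) (↔-sym +↔⊎)

Block-zero↔ : {A : Set} → Block A zero ↔ A
Block-zero↔ = mk↔ₛ′ Block.hd (λ a → block a [] z≤n) (λ _ → refl)
  λ { (block a [] z≤n) → refl ; (block a (_ ∷ _) ()) }

Block-suc↔ : {A : Set} (e : ℕ) → Block A (suc e) ↔ (A × (⊤ ⊎ Block A e))
Block-suc↔ {A} e = mk↔ₛ′ to from
  (λ { (a , inj₁ tt) → refl ; (a , inj₂ (block b t p)) → refl })
  (λ { (block a [] z≤n) → refl ; (block a (b ∷ t) (s≤s p)) → refl })
  where
  to : Block A (suc e) → A × (⊤ ⊎ Block A e)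
  to (block a [] _) = a , inj₁ tt
  to (block a (b ∷ t) (s≤s p)) = a , inj₂ (block b t p)
  from : A × (⊤ ⊎ Block A e) → Block A (suc e)
  from (a , inj₁ tt) = block a [] z≤n
  from (a , inj₂ (block b t p)) = block a (b ∷ t) (s≤s p)

Block-finite : {A : Set} → IsFinite A → (e : ℕ) → IsFinite (Block A e)
Block-finite fA zero = IsFinite-↔ Block-zero↔ fA
Block-finite fA (suc e) = IsFinite-↔ (Block-suc↔ e) (IsFinite-× fA (IsFinite-⊤⊎ (Block-finite fA e)))

block-cong : {A : Set} {e : ℕ} {a : A} {t t′ : List A} {p : length t ≤ e} {p′ : length t′ ≤ e} →
  t ≡ t′ → block a t p ≡ block a t′ p′
block-cong {p = p} {p′} refl = cong (block _ _) (≤-irrelevant p p′)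

length-take-≤ : {A : Set} (n : ℕ) (xs : List A) → length (take n xs) ≤ n
length-take-≤ n xs = ≤-trans (≤-reflexive (length-take n xs)) (m⊓n≤m n (length xs))

length-drop-≤ : {A : Set} (n : ℕ) (xs : List A) → length (drop n xs) ≤ length xs
length-drop-≤ n xs = ≤-trans (≤-reflexive (length-drop n xs)) (m∸n≤m (length xs) n)

take-++-≤ : {A : Set} (n : ℕ) (xs ys : List A) → n ≤ length xs → take n (xs ++ ys) ≡ take n xs
take-++-≤ zero xs ys _ = refl
take-++-≤ (suc n) (x ∷ xs) ys (s≤s n≤) = cong (x ∷_) (take-++-≤ n xs ys n≤)

drop-++-≤ : {A : Set} (n : ℕ) (xs ys : List A) → n ≤ length xs → drop n (xs ++ ys) ≡ drop n xs ++ ys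
drop-++-≤ zero xs ys _ = refl
drop-++-≤ (suc n) (x ∷ xs) ys (s≤s n≤) = drop-++-≤ n xs ys n≤

blocksF-fuel : {A : Set} (e k k′ : ℕ) (w : List A) → length w ≤ k → length w ≤ k′ →
  blocksF e k w ≡ blocksF e k′ w
blocksF-fuel e zero zero w _ _ = refl
blocksF-fuel e zero (suc k′) [] _ _ = refl
blocksF-fuel e (suc k) zero [] _ _ = refl
blocksF-fuel e (suc k) (suc k′) [] _ _ = refl
blocksF-fuel e (suc k) (suc k′) (a ∷ w) (s≤s w≤k) (s≤s w≤k′) = cong (_ ∷_)
  (blocksF-fuel e k k′ (drop e w)
    (≤-trans (length-drop-≤ e w) w≤k) (≤-trans (length-drop-≤ e w) w≤k′))

μ-∷ : {A : Set} (e : ℕ) (a : A) (w : List A) →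
  μ e (a ∷ w) ≡ block a (take e w) (length-take-≤ e w) ∷ μ e (drop e w)
μ-∷ e a w = cong₂ _∷_ (block-cong refl)
  (blocksF-fuel e (length w) (length (drop e w)) (drop e w) (length-drop-≤ e w) ≤-refl)

μ-++ : {A : Set} (e : ℕ) (u v : List A) → suc e ∣ length u → μ e (u ++ v) ≡ μ e u ++ μ e v
μ-++ e u v (divides m len≡) = go m u len≡
  where
  open ≡-Reasoning
  go : ∀ m u → length u ≡ m * suc e → μ e (u ++ v) ≡ μ e u ++ μ e v
  go zero [] _ = refl
  go (suc m) (a ∷ u) len≡ = begin
      μ e (a ∷ u ++ v)
    ≡⟨ μ-∷ e a (u ++ v) ⟩
      block a (take e (u ++ v)) _ ∷ μ e (drop e (u ++ v))
    ≡⟨ cong₂ _∷_ (block-cong (take-++-≤ e u v e≤)) (cong (μ e) (drop-++-≤ e u v e≤)) ⟩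
      block a (take e u) _ ∷ μ e (drop e u ++ v)
    ≡⟨ cong (_ ∷_) (go m (drop e u) rest≡) ⟩
      block a (take e u) _ ∷ (μ e (drop e u) ++ μ e v)
    ≡⟨ cong (_++ μ e v) (sym (μ-∷ e a u)) ⟩
      μ e (a ∷ u) ++ μ e v
    ∎
    where
    u≡ : length u ≡ e + m * suc e
    u≡ = suc-injective len≡
    e≤ : e ≤ length u
    e≤ = ≤-trans (m≤m+n e (m * suc e)) (≤-reflexive (sym u≡))
    rest≡ : length (drop e u) ≡ m * suc e
    rest≡ = trans (length-drop e u) (trans (cong (_∸ e) u≡) (m+n∸m≡n e (m * suc e)))

reblock : {A : Set} (e : ℕ) {e′ : ℕ} → Block A e′ → List (Block A e)
reblock e (block a t _) = μ e (a ∷ t)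

reblock≢[] : {A : Set} (e : ℕ) {e′ : ℕ} (b : Block A e′) → reblock e b ≢ []
reblock≢[] e (block a t _) ()

μ-∷-take++drop : {A : Set} (e e′ : ℕ) → suc e ∣ suc e′ → (a : A) (w : List A) →
  μ e (a ∷ take e′ w) ++ μ e (drop e′ w) ≡ μ e (a ∷ w)
μ-∷-take++drop e e′ d∣d′ a w with e′ ≤? length w
... | yes e′≤ = trans
  (sym (μ-++ e (a ∷ take e′ w) (drop e′ w) d∣len))
  (cong (λ z → μ e (a ∷ z)) (take++drop≡id e′ w))
  where
  d∣len : suc e ∣ suc (length (take e′ w))
  d∣len rewrite length-take e′ w | m≤n⇒m⊓n≡m e′≤ = d∣d′
... | no e′≰ = begin
    μ e (a ∷ take e′ w) ++ μ e (drop e′ w)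
  ≡⟨ cong (λ z → μ e (a ∷ take e′ w) ++ μ e z) (drop-all e′ w w≤) ⟩
    μ e (a ∷ take e′ w) ++ []
  ≡⟨ ++-identityʳ _ ⟩
    μ e (a ∷ take e′ w)
  ≡⟨ cong (λ z → μ e (a ∷ z)) (take-all e′ w w≤) ⟩
    μ e (a ∷ w)
  ∎
  where
  open ≡-Reasoning
  w≤ : length w ≤ e′
  w≤ = <⇒≤ (≰⇒> e′≰)

morph-reblock-μ : {A : Set} (e e′ : ℕ) → suc e ∣ suc e′ → (w : List A) →
  morph (reblock e) (μ e′ w) ≡ μ e w
morph-reblock-μ {A} e e′ d∣d′ w = go (length w) w ≤-refl
  where
  go : ∀ k (w : List A) → length w ≤ k → morph (reblock e) (blocksF e′ k w) ≡ μ e w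
  go zero [] _ = refl
  go (suc k) [] _ = refl
  go (suc k) (a ∷ w) (s≤s w≤k) = trans
    (cong (μ e (a ∷ take e′ w) ++_) (go k (drop e′ w) (≤-trans (length-drop-≤ e′ w) w≤k)))
    (μ-∷-take++drop e e′ d∣d′ a w)

BlockAbsAt : ClassOfLangs → (A : Set) → ℕ → Lang A → Set
BlockAbsAt C A e L = Σ (Lang (Block A e)) λ K → C (Block A e) K × (∀ w → L w ≡ K (μ e w))

BlockAbsAt-refine : (C : ClassOfLangs) {A : Set} {e e′ : ℕ} {L : Lang A} →
  ClosedInvLenIncr C → IsFinite A → suc e ∣ suc e′ → BlockAbsAt C A e L → BlockAbsAt C A e′ L
BlockAbsAt-refine C {A} {e} {e′} closed fA d∣d′ (K , K∈C , L≡K∘μ) =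
  (λ v → K (morph (reblock e) v)) ,
  closed (Block A e′) (Block A e) (Block-finite fA e′) (Block-finite fA e) (reblock e) (reblock≢[] e) K K∈C ,
  λ w → trans (L≡K∘μ w) (cong K (sym (morph-reblock-μ e e′ d∣d′ w)))

BlockAbsAt-pointwise : (C : ClassOfLangs) {A : Set} {e : ℕ} {L L′ : Lang A} (op : Bool → Bool → Bool) →
  (∀ K K′ → C (Block A e) K → C (Block A e) K′ → C (Block A e) (λ v → op (K v) (K′ v))) →
  BlockAbsAt C A e L → BlockAbsAt C A e L′ → BlockAbsAt C A e (λ w → op (L w) (L′ w))
BlockAbsAt-pointwise C op closed (K , K∈C , L≡) (K′ , K′∈C , L′≡) =
  (λ v → op (K v) (K′ v)) , closed K K′ K∈C K′∈C , λ w → cong₂ op (L≡ w) (L′≡ w)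

BlockAbs-pointwise : (C : ClassOfLangs) {A : Set} {L L′ : Lang A} →
  ClosedInvLenIncr C → IsFinite A → (op : Bool → Bool → Bool) →
  (∀ e K K′ → C (Block A e) K → C (Block A e) K′ → C (Block A e) (λ v → op (K v) (K′ v))) →
  BlockAbs C A L → BlockAbs C A L′ → BlockAbs C A (λ w → op (L w) (L′ w))
-- suc e * suc e′ reduces to suc (e′ + e * suc e′), the common block size.
BlockAbs-pointwise C closed fA op op-closed (e , L∈) (e′ , L′∈) =
  e′ + e * suc e′ ,
  BlockAbsAt-pointwise C op (op-closed _)
    (BlockAbsAt-refine C closed fA (m∣m*n (suc e′)) L∈)
    (BlockAbsAt-refine C closed fA (n∣m*n (suc e)) L′∈)

corollary6p5 : (C : ClassOfLangs) → IsClass C → IsLattice C → ClosedInvLenIncr C →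
    IsLattice (BlockAbs C)
corollary6p5 C _ lattice closed A fA with lattice (Block A 0) (Block-finite fA 0)
... | ∅∈ , Full∈ , _ =
  (0 , ∅ₗ , ∅∈ , λ _ → refl) ,
  (0 , Fullₗ , Full∈ , λ _ → refl) ,
  (λ _ _ → BlockAbs-pointwise C closed fA _∨_ ∪-closed) ,
  (λ _ _ → BlockAbs-pointwise C closed fA _∧_ ∩-closed)
  where
  ∪-closed : ∀ e K K′ → C (Block A e) K → C (Block A e) K′ → C (Block A e) (K ∪ₗ K′)
  ∪-closed e = proj₁ (proj₂ (proj₂ (lattice (Block A e) (Block-finite fA e))))
  ∩-closed : ∀ e K K′ → C (Block A e) K → C (Block A e) K′ → C (Block A e) (K ∩ₗ K′)
  ∩-closed e = proj₂ (proj₂ (proj₂ (lattice (Block A e) (Block-finite fA e))))
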